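{- Let $G,H$ be graphs with $H\leq_R G$ and let $\Phi\in\hom_R(G,H)$. Let $I\in V(H)$, and suppose there exist $I_1,I_2\in(\partial\Phi)^{ -1}(I)$ such that $|E_{I_1J}(G)|=|E_{I_2J}(G)|$ for all $J\in V(G)$. Then there exists $\Phi'\in\hom_R(G,H)$ such that $I_1\sim_{\Phi'}I_2$.
   Context: All graphs are finite directed graphs with state set $V(G)$, edge set $E(G)$, source/target maps $s,t$; loops and parallel edges allowed; all graphs sink-free. $E_I(G)=s^{ -1}(I)$, $E_{IJ}(G)=E_I(G)\cap t^{ -1}(J)$, $L_I(G)$ finite edge paths starting at $I$. A homomorphism consists of maps on edges and ($\partial\Phi$) on states commuting with $s,t$. A right-resolver is a surjective homomorphism with $\Phi|_{E_I(G)}:E_I(G)\to E_{\partial\Phi(I)}(H)$ bijective for all $I$; $\hom_R(G,H)$, $H\leq_R G$ if nonempty. For $u\in L_{\partial\Phi(I)}(H)$, $I\cdot u$ is the endpoint of the unique lift of $u$ starting at $I$. Stability: $I_1\sim_\Phi I_2$ iff $\partial\Phi(I_1)=\partial\Phi(I_2)=:I$ and for every $u\in L_I(H)$ there is $v\in L_{t(u)}(H)$ with $I_1\cdot uv=I_2\cdot uv$. -}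

module Defs where

open import Data.Nat using (ℕ)
open import Data.Fin using (Fin; _≟_)
open import Data.List using (List; length; filter; allFin)
open import Data.Product using (Σ; ∃; _×_; _,_; proj₁; proj₂)
open import Relation.Nullary using (Dec)
open import Relation.Nullary.Decidable using (_×-dec_)
open import Relation.Binary.PropositionalEquality using (_≡_; subst; sym; trans; cong)
open import Function using (Surjective)

record Graph : Set where
  field
    nV : ℕ
    nE : ℕ
    s  : Fin nE → Fin nV
    t  : Fin nE → Fin nV
    sinkFree : ∀ (I : Fin nV) → ∃ λ (e : Fin nE) → s e ≡ I

  State = Fin nV
  Edge  = Fin nE

open Graph public

card-E : (G : Graph) → State G → State G → ℕ
card-E G I J = length (filter (λ e → (s G e ≟ I) ×-dec (t G e ≟ J)) (allFin (nE G)))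

record Hom (G H : Graph) : Set where
  field
    φ  : Edge G → Edge H
    ∂φ : State G → State H
    comm-s : ∀ e → s H (φ e) ≡ ∂φ (s G e)
    comm-t : ∀ e → t H (φ e) ≡ ∂φ (t G e)

open Hom public

record RightResolver (G H : Graph) : Set where
  field
    hom    : Hom G H
    surjE  : ∀ (e : Edge H) → ∃ λ (e' : Edge G) → φ hom e' ≡ e
    surjV  : ∀ (J : State H) → ∃ λ (I : State G) → ∂φ hom I ≡ J
    injI   : ∀ (e₁ e₂ : Edge G) → s G e₁ ≡ s G e₂ → φ hom e₁ ≡ φ hom e₂ → e₁ ≡ e₂
    liftI  : ∀ (I : State G) (e : Edge H) → s H e ≡ ∂φ hom I →
             Σ (Edge G) λ e' → (s G e' ≡ I) × (φ hom e' ≡ e)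

open RightResolver public

homR : Graph → Graph → Set
homR = RightResolver

data Path (G : Graph) : State G → Set where
  []  : ∀ {I} → Path G I
  _∷_⟨_⟩ : ∀ {I} (e : Edge G) → s G e ≡ I → Path G (t G e) → Path G I

endP : ∀ {G I} → Path G I → State G
endP {I = I} [] = I
endP (e ∷ _ ⟨ p ⟩) = endP p

_++P_ : ∀ {G I} (u : Path G I) → Path G (endP u) → Path G I
[] ++P v = v
(e ∷ q ⟨ p ⟩) ++P v = e ∷ q ⟨ p ++P v ⟩

-- I · u : endpoint of the unique lift of u starting at I
-- (auxiliary form: path from a state K of H known to equal ∂Φ(I))
dot′ : ∀ {G H} (Φ : RightResolver G H) (I : State G) {K : State H} →
       ∂φ (hom Φ) I ≡ K → Path H K → State G
dot′ Φ I eq [] = I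
dot′ {G} {H} Φ I eq (e ∷ q ⟨ p ⟩) with liftI Φ I e (trans q (sym eq))
... | e' , _ , φe'≡e = dot′ Φ (t G e') (trans (sym (comm-t (hom Φ) e')) (cong (t H) φe'≡e)) p

dot : ∀ {G H} (Φ : RightResolver G H) (I : State G) → Path H (∂φ (hom Φ) I) → State G
dot Φ I u = dot′ Φ I _≡_.refl u

Stable : ∀ {G H} (Φ : RightResolver G H) → State G → State G → Set
Stable {G} {H} Φ I₁ I₂ =
  Σ (∂φ (hom Φ) I₁ ≡ ∂φ (hom Φ) I₂) λ eq →
    ∀ (u : Path H (∂φ (hom Φ) I₁)) →
      ∃ λ (v : Path H (endP u)) →
        dot Φ I₁ (u ++P v) ≡ dot Φ I₂ (subst (Path H) eq (u ++P v))

-- In a right-resolver the out-edges of a state I₂ are matched bijectively with the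
-- out-edges of ∂Φ(I₂) in H.  If I₁ has the same image and the same number of edges to
-- every state J as I₂, one may re-label the out-edges of I₂: send each edge to the
-- H-label of a chosen edge from I₁ with the same target.  The result is again a
-- right-resolver, and in it the lifts of any H-edge from I₁ and from I₂ end at the same
-- state; hence after one step every path from I₁ and I₂ is synchronised.
module Submission where

open import Defs
open import Data.Empty using (⊥-elim)
open import Data.Fin using (Fin; zero; suc; cast) renaming (_≟_ to _≟F_)
open import Data.Fin.Properties using (cast-involutive)
open import Data.List using (List; _∷_; length; filter; allFin; lookup)
open import Data.List.Membership.Propositional using (_∈_)
open import Data.List.Membership.Propositional.Properties
  using (∈-filter⁺; ∈-filter⁻; ∈-allFin; ∈-lookup)
import Data.List.Membership.Setoid.Properties as SetoidMembership
open import Data.List.Relation.Unary.All as All using ()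
open import Data.List.Relation.Unary.AllPairs using (_∷_)
open import Data.List.Relation.Unary.Any using (index)
open import Data.List.Relation.Unary.Any.Properties using (lookup-index)
open import Data.List.Relation.Unary.Unique.Propositional using (Unique)
import Data.List.Relation.Unary.Unique.Propositional.Properties as Unique
open import Data.Nat using (ℕ)
open import Data.Product using (Σ; ∃; _×_; _,_; proj₁; proj₂)
open import Level using (0ℓ)
open import Relation.Binary.Definitions using (DecidableEquality)
open import Relation.Binary.PropositionalEquality
  using (_≡_; refl; sym; trans; cong; subst; setoid; module ≡-Reasoning)
open import Relation.Nullary using (Dec; yes; no)
open import Relation.Nullary.Decidable using (_×-dec_)
open import Relation.Unary using (Pred; Decidable)
import Axiom.UniquenessOfIdentityProofs as UIP

module _ {A : Set} where

  lookup-injective : ∀ {xs : List A} → Unique xs →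
                     ∀ i j → lookup xs i ≡ lookup xs j → i ≡ j
  lookup-injective (_   ∷ _) zero    zero    _  = refl
  lookup-injective (x∉ ∷ _) zero    (suc j) eq = ⊥-elim (All.lookup x∉ (∈-lookup j) eq)
  lookup-injective (x∉ ∷ _) (suc i) zero    eq = ⊥-elim (All.lookup x∉ (∈-lookup i) (sym eq))
  lookup-injective (_   ∷ u) (suc i) (suc j) eq = cong suc (lookup-injective u i j eq)

  index-irrelevant : ∀ {x} {xs : List A} → Unique xs → (p q : x ∈ xs) → index p ≡ index q
  index-irrelevant u p q = lookup-injective u _ _ (trans (sym (lookup-index p)) (lookup-index q))

  module Transfer {xs ys : List A} (eq : length xs ≡ length ys) where

    transfer : ∀ {x} → x ∈ xs → A
    transfer p = lookup ys (cast eq (index p))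

    transfer-∈ : ∀ {x} (p : x ∈ xs) → transfer p ∈ ys
    transfer-∈ p = ∈-lookup _

    transfer-irrelevant : Unique xs → ∀ {x} (p q : x ∈ xs) → transfer p ≡ transfer q
    transfer-irrelevant u p q = cong (λ i → lookup ys (cast eq i)) (index-irrelevant u p q)

    transfer-injective : Unique ys → ∀ {x y} (p : x ∈ xs) (q : y ∈ xs) →
                         transfer p ≡ transfer q → x ≡ y
    transfer-injective u p q h = SetoidMembership.index-injective (setoid A) p q (begin
      index p                          ≡⟨ sym (cast-involutive (sym eq) eq _) ⟩
      cast (sym eq) (cast eq (index p)) ≡⟨ cong (cast (sym eq)) (lookup-injective u _ _ h) ⟩
      cast (sym eq) (cast eq (index q)) ≡⟨ cast-involutive (sym eq) eq _ ⟩
      index q                          ∎)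
      where open ≡-Reasoning

    transfer-surjective : ∀ {y} → y ∈ ys → Σ A λ x → Σ (x ∈ xs) λ p → transfer p ≡ y
    transfer-surjective q = lookup xs i , ∈-lookup i , (begin
      lookup ys (cast eq (index (∈-lookup {xs = xs} i))) ≡⟨ cong (λ j → lookup ys (cast eq j))
                                                              (index-∈-lookup xs i) ⟩
      lookup ys (cast eq i)                               ≡⟨ cong (lookup ys)
                                                              (cast-involutive eq (sym eq) _) ⟩
      lookup ys (index q)                                 ≡⟨ sym (lookup-index q) ⟩
      _                                                   ∎)
      where
      open ≡-Reasoning
      i = cast (sym eq) (index q)
      index-∈-lookup : ∀ zs k → index (∈-lookup {xs = zs} k) ≡ k
      index-∈-lookup (_ ∷ _)  zero    = refl
      index-∈-lookup (_ ∷ zs) (suc k) = cong suc (index-∈-lookup zs k)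

record LabelPreservingBijection {n : ℕ} {B : Set} (label : Fin n → B)
                               (P Q : Pred (Fin n) 0ℓ) : Set where
  field
    fun            : ∀ e → P e → Fin n
    fun-codomain   : ∀ e p → Q (fun e p)
    fun-label      : ∀ e p → label (fun e p) ≡ label e
    fun-irrelevant : ∀ e p p′ → fun e p ≡ fun e p′
    fun-injective  : ∀ e₁ p₁ e₂ p₂ → fun e₁ p₁ ≡ fun e₂ p₂ → e₁ ≡ e₂
    fun-surjective : ∀ y → Q y → Σ (Fin n) λ e → Σ (P e) λ p → fun e p ≡ y

module _ {n : ℕ} {B : Set} (_≟B_ : DecidableEquality B) (label : Fin n → B) where

  labelled : {P : Pred (Fin n) 0ℓ} → Decidable P → (J : B) →
             Decidable (λ e → P e × label e ≡ J)
  labelled P? J e = P? e ×-dec (label e ≟B J)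

  count : {P : Pred (Fin n) 0ℓ} → Decidable P → B → ℕ
  count P? J = length (filter (labelled P? J) (allFin n))

  module _ {P Q : Pred (Fin n) 0ℓ} (P? : Decidable P) (Q? : Decidable Q)
           (equal-counts : ∀ J → count P? J ≡ count Q? J) where

    private
      withLabel : {R : Pred (Fin n) 0ℓ} → Decidable R → B → List (Fin n)
      withLabel R? J = filter (labelled R? J) (allFin n)

      unique : {R : Pred (Fin n) 0ℓ} (R? : Decidable R) (J : B) → Unique (withLabel R? J)
      unique R? J = Unique.filter⁺ _ (Unique.allFin⁺ n)

      ∈-withLabel : {R : Pred (Fin n) 0ℓ} (R? : Decidable R) {J : B} →
                    ∀ e → R e → label e ≡ J → e ∈ withLabel R? J
      ∈-withLabel R? e r q = ∈-filter⁺ _ (∈-allFin e) (r , q)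

      module T (J : B) = Transfer {xs = withLabel P? J} {ys = withLabel Q? J} (equal-counts J)

      matchAt : ∀ J e p (q : label e ≡ J) → Fin n
      matchAt J e p q = T.transfer J (∈-withLabel P? e p q)

      match : ∀ e → P e → Fin n
      match e p = matchAt (label e) e p refl

      match≡matchAt : ∀ J e p p′ (q : label e ≡ J) → match e p ≡ matchAt J e p′ q
      match≡matchAt J e p p′ refl = T.transfer-irrelevant _ (unique P? _) _ _

      match-properties : ∀ e p → Q (match e p) × label (match e p) ≡ label e
      match-properties e p =
        proj₂ (∈-filter⁻ (labelled Q? (label e)) {xs = allFin n}
                 (T.transfer-∈ _ (∈-withLabel P? e p refl)))

    equal-counts⇒bijection : LabelPreservingBijection label P Q
    equal-counts⇒bijection = record
      { fun            = match
      ; fun-codomain   = λ e p → proj₁ (match-properties e p)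
      ; fun-label      = λ e p → proj₂ (match-properties e p)
      ; fun-irrelevant = λ e p p′ → match≡matchAt (label e) e p p′ refl
      ; fun-injective  = injective
      ; fun-surjective = surjective
      }
      where
      injective : ∀ e₁ p₁ e₂ p₂ → match e₁ p₁ ≡ match e₂ p₂ → e₁ ≡ e₂
      injective e₁ p₁ e₂ p₂ h =
        T.transfer-injective J (unique Q? J)
          (∈-withLabel P? e₁ p₁ refl) (∈-withLabel P? e₂ p₂ same-label)
          (trans (sym (match≡matchAt J e₁ p₁ p₁ refl))
                 (trans h (match≡matchAt J e₂ p₂ p₂ same-label)))
        where
        J = label e₁
        same-label : label e₂ ≡ J
        same-label = trans (sym (proj₂ (match-properties e₂ p₂)))
                       (trans (cong label (sym h)) (proj₂ (match-properties e₁ p₁)))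

      surjective : ∀ y → Q y → Σ (Fin n) λ e → Σ (P e) λ p → match e p ≡ y
      surjective y qy with T.transfer-surjective (label y) (∈-withLabel Q? y qy refl)
      ... | e , e∈ , transfer≡y with ∈-filter⁻ (labelled P? (label y)) {xs = allFin n} e∈
      ...   | _ , p , q = e , p , trans (match≡matchAt _ e p p q)
                                    (trans (T.transfer-irrelevant _ (unique P? _) _ _) transfer≡y)

module _ {G H : Graph} (Φ : RightResolver G H) where

  private
    ∂ = ∂φ (hom Φ)

  LiftsAgree : State G → State G → Set
  LiftsAgree I₁ I₂ = ∀ e₁ e₂ → s G e₁ ≡ I₁ → s G e₂ ≡ I₂ →
                     φ (hom Φ) e₁ ≡ φ (hom Φ) e₂ → t G e₁ ≡ t G e₂

  dot′-irrelevant : ∀ {A B : State G} {K} → A ≡ B → (eqA : ∂ A ≡ K) (eqB : ∂ B ≡ K)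
                    (u : Path H K) → dot′ Φ A eqA u ≡ dot′ Φ B eqB u
  dot′-irrelevant refl eqA eqB u with UIP.Decidable⇒UIP.≡-irrelevant _≟F_ eqA eqB
  ... | refl = refl

  dot′-synchronised : ∀ {I₁ I₂} → LiftsAgree I₁ I₂ →
                      ∀ {K₁ K₂} (r : K₁ ≡ K₂) (eq₁ : ∂ I₁ ≡ K₁) (eq₂ : ∂ I₂ ≡ K₂)
                      e (q : s H e ≡ K₁) (u : Path H (t H e)) →
                      dot′ Φ I₁ eq₁ (e ∷ q ⟨ u ⟩) ≡ dot′ Φ I₂ eq₂ (subst (Path H) r (e ∷ q ⟨ u ⟩))
  dot′-synchronised {I₁} {I₂} agree refl eq₁ eq₂ e q u
    with liftI Φ I₁ e (trans q (sym eq₁)) | liftI Φ I₂ e (trans q (sym eq₂))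
  ... | e₁ , s₁ , φ₁ | e₂ , s₂ , φ₂ =
    dot′-irrelevant (agree e₁ e₂ s₁ s₂ (trans φ₁ (sym φ₂))) _ _ u

  liftsAgree⇒stable : ∀ {I₁ I₂} → ∂ I₁ ≡ ∂ I₂ → LiftsAgree I₁ I₂ → Stable Φ I₁ I₂
  liftsAgree⇒stable {I₁} {I₂} same agree = same , synchronise
    where
    synchronise : ∀ u → ∃ λ (v : Path H (endP u)) →
                  dot Φ I₁ (u ++P v) ≡ dot Φ I₂ (subst (Path H) same (u ++P v))
    synchronise [] with sinkFree H (∂ I₁)
    ... | e , q = e ∷ q ⟨ [] ⟩ , dot′-synchronised agree same refl refl e q []
    synchronise (e ∷ q ⟨ u ⟩) = [] , dot′-synchronised agree same refl refl e q (u ++P [])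

module Relabel {G H : Graph} (Φ : RightResolver G H) {I₁ I₂ : State G}
  (same-image : ∂φ (hom Φ) I₁ ≡ ∂φ (hom Φ) I₂)
  (σ : LabelPreservingBijection (t G) (λ e → s G e ≡ I₂) (λ e → s G e ≡ I₁)) where

  open LabelPreservingBijection σ

  private
    ∂ = ∂φ (hom Φ)
    φ₀ = φ (hom Φ)

  relabel : ∀ e → Dec (s G e ≡ I₂) → Edge H
  relabel e (yes p) = φ₀ (fun e p)
  relabel e (no _)  = φ₀ e

  φ′ : Edge G → Edge H
  φ′ e = relabel e (s G e ≟F I₂)

  φ′≡relabel : ∀ e (d : Dec (s G e ≡ I₂)) → φ′ e ≡ relabel e d
  φ′≡relabel e d with s G e ≟F I₂ | d
  ... | yes p | yes p′ = cong φ₀ (fun-irrelevant e p p′)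
  ... | yes p | no ¬p  = ⊥-elim (¬p p)
  ... | no ¬p | yes p  = ⊥-elim (¬p p)
  ... | no _  | no _   = refl

  relabel-s : ∀ e d → s H (relabel e d) ≡ ∂ (s G e)
  relabel-s e (yes p) = begin
    s H (φ₀ (fun e p)) ≡⟨ comm-s (hom Φ) (fun e p) ⟩
    ∂ (s G (fun e p))  ≡⟨ cong ∂ (fun-codomain e p) ⟩
    ∂ I₁               ≡⟨ same-image ⟩
    ∂ I₂               ≡⟨ cong ∂ (sym p) ⟩
    ∂ (s G e)          ∎
    where open ≡-Reasoning
  relabel-s e (no _) = comm-s (hom Φ) e

  relabel-t : ∀ e d → t H (relabel e d) ≡ ∂ (t G e)
  relabel-t e (yes p) = trans (comm-t (hom Φ) (fun e p)) (cong ∂ (fun-label e p))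
  relabel-t e (no _)  = comm-t (hom Φ) e

  hom′ : Hom G H
  hom′ = record
    { φ = φ′ ; ∂φ = ∂
    ; comm-s = λ e → relabel-s e (s G e ≟F I₂)
    ; comm-t = λ e → relabel-t e (s G e ≟F I₂)
    }

  φ′-injective-on-E : ∀ e₁ e₂ → s G e₁ ≡ s G e₂ → φ′ e₁ ≡ φ′ e₂ → e₁ ≡ e₂
  -- the with-abstraction also unfolds φ′ e₁ in the type of h
  φ′-injective-on-E e₁ e₂ same-s h with s G e₁ ≟F I₂
  ... | yes p = fun-injective e₁ p e₂ p₂
                  (injI Φ _ _ (trans (fun-codomain e₁ p) (sym (fun-codomain e₂ p₂)))
                    (trans h (φ′≡relabel e₂ (yes p₂))))
    where p₂ = trans (sym same-s) p
  ... | no ¬p = injI Φ e₁ e₂ same-s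
                  (trans h (φ′≡relabel e₂ (no λ p₂ → ¬p (trans same-s p₂))))

  φ′-lift : ∀ K e → s H e ≡ ∂ K → Σ (Edge G) λ e′ → (s G e′ ≡ K) × (φ′ e′ ≡ e)
  φ′-lift K e q with K ≟F I₂
  ... | yes refl with liftI Φ I₁ e (trans q (sym same-image))
  ...   | e₁ , s₁ , φ₁ with fun-surjective e₁ s₁
  ...     | e₀ , p₀ , fun≡e₁ =
    e₀ , p₀ , trans (φ′≡relabel e₀ (yes p₀)) (trans (cong φ₀ fun≡e₁) φ₁)
  φ′-lift K e q | no K≢I₂ with liftI Φ K e q
  ... | e₁ , s₁ , φ₁ = e₁ , s₁ , trans (φ′≡relabel e₁ (no λ p → K≢I₂ (trans (sym s₁) p))) φ₁

  relabelled : RightResolver G H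
  relabelled = record
    { hom   = hom′
    ; surjE = λ e → let J , ∂J≡ = surjV Φ (s H e)
                        e′ , _ , φ′e′≡e = φ′-lift J e (sym ∂J≡)
                    in e′ , φ′e′≡e
    ; surjV = surjV Φ
    ; injI  = φ′-injective-on-E
    ; liftI = φ′-lift
    }

  relabelled-liftsAgree : LiftsAgree relabelled I₁ I₂
  relabelled-liftsAgree e₁ e₂ s₁ s₂ h with s G e₁ ≟F I₂
  ... | yes p =
    cong (t G) (φ′-injective-on-E e₁ e₂ (trans p (sym s₂)) (trans (φ′≡relabel e₁ (yes p)) h))
  ... | no ¬p = trans (cong (t G) e₁≡partner) (fun-label e₂ s₂)
    where
    e₁≡partner : e₁ ≡ fun e₂ s₂
    e₁≡partner = injI Φ _ _ (trans s₁ (sym (fun-codomain e₂ s₂)))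
                   (trans h (φ′≡relabel e₂ (yes s₂)))

lemma3p13 : (G H : Graph) (Φ : RightResolver G H) (I : State H)
    (I₁ I₂ : State G) → ∂φ (hom Φ) I₁ ≡ I → ∂φ (hom Φ) I₂ ≡ I →
    (∀ (J : State G) → card-E G I₁ J ≡ card-E G I₂ J) →
    ∃ λ (Φ' : RightResolver G H) → Stable Φ' I₁ I₂
lemma3p13 G H Φ I I₁ I₂ ∂I₁≡I ∂I₂≡I equal-counts =
  relabelled , liftsAgree⇒stable relabelled same-image relabelled-liftsAgree
  where
  same-image = trans ∂I₁≡I (sym ∂I₂≡I)
  matching : LabelPreservingBijection (t G) (λ e → s G e ≡ I₂) (λ e → s G e ≡ I₁)
  matching = equal-counts⇒bijection _≟F_ (t G) (λ e → s G e ≟F I₂) (λ e → s G e ≟F I₁)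
               (λ J → sym (equal-counts J))
  open Relabel Φ same-image matching
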